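{- Let $k\ge 2$ and let $\Gamma$ be a finite group with $|\Gamma|>1$. Let $m_k(\Gamma)$ be the number of integers $\ell$ with $2\le\ell\le k$ for which $\Gamma$ contains an element of order $\ell$, and let $n_k(\Gamma)$ be the number of elements of $\Gamma$ of order larger than $k$. Then $$M_k(\Gamma)\le m_k(\Gamma)+n_k(\Gamma).$$
   Context: For a group $\Gamma$, $A\subseteq\Gamma$ is an $S_k$-set if whenever $\alpha_1\cdots\alpha_k=\beta_1\cdots\beta_k$ with all $\alpha_i,\beta_i\in A$, we have $(\alpha_1,\ldots,\alpha_k)=(\beta_1,\ldots,\beta_k)$. $M_k(\Gamma)$ denotes the maximum size of an $S_k$-set in $\Gamma$. -}

module Defs where

open import Data.Nat using (ℕ; zero; suc; _≤_; _<_)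
open import Data.Fin using (Fin; toℕ)
open import Data.Fin.Subset using (Subset; _∈_)
open import Data.Vec using (Vec; foldr)
open import Data.Vec.Relation.Unary.All using (All)
open import Data.Product using (_×_; ∃; Σ)
open import Relation.Binary.PropositionalEquality using (_≡_; _≢_)
open import Function.Bundles using (_⇔_)

-- A finite group is given on the carrier Fin n with propositional equality,
-- operations _∙_, ε, _⁻¹ (group axioms supplied as an IsGroup proof in the statement).
module _ {n : ℕ} (_∙_ : Fin n → Fin n → Fin n) (ε : Fin n) where

  pow : Fin n → ℕ → Fin n
  pow g zero    = ε
  pow g (suc m) = g ∙ pow g m

  HasOrder : Fin n → ℕ → Set
  HasOrder g ℓ = (1 ≤ ℓ) × (pow g ℓ ≡ ε) × (∀ j → 1 ≤ j → j < ℓ → pow g j ≢ ε)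

  prod : ∀ {k} → Vec (Fin n) k → Fin n
  prod = foldr _ _∙_ ε

  IsSk : ℕ → Subset n → Set
  IsSk k A = (α β : Vec (Fin n) k) → All (_∈ A) α → All (_∈ A) β →
             prod α ≡ prod β → α ≡ β

  IsMkSet : (k : ℕ) → Subset (suc k) → Set
  IsMkSet k L = (ℓ : Fin (suc k)) →
    (ℓ ∈ L) ⇔ ((2 ≤ toℕ ℓ) × ∃ λ g → HasOrder g (toℕ ℓ))

  IsNkSet : ℕ → Subset n → Set
  IsNkSet k N = (g : Fin n) → (g ∈ N) ⇔ (∃ λ o → HasOrder g o × k < o)

{-# OPTIONS --safe #-}

-- If a, b ∈ A and a ^ p = 1 with 1 ≤ p < k, the words a ^ p b ^ (k - p) and b ^ (k - p) a ^ p
-- have the same product, so the S_k property forces a = b; and the constant words a ^ k, b ^ k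
-- show that x ↦ x ^ k is injective on A. Hence A has at most one element a of order ≤ k, and
-- ∣ A ∣ ≤ n_k + 1. The order of a is counted by m_k unless a = 1; but then A = {1} (as k ≥ 2),
-- and any nontrivial element of Γ makes m_k + n_k ≥ 1.
module Submission where

open import Defs
open import Algebra.Bundles using (Group)
open import Algebra.Structures using (IsMonoid; IsGroup)
open import Data.Nat using (ℕ; zero; suc; _≤_; _<_; _+_; _∸_; z≤n; s≤s; _≤?_; _<?_)
open import Data.Nat.Induction using (<-wellFounded)
open import Data.Nat.Properties
open import Data.Fin using (Fin; zero; toℕ; fromℕ<; punchIn)
open import Data.Fin.Properties using (pigeonhole; any?; toℕ-fromℕ<; punchInᵢ≢i) renaming (_≟_ to _≟ᶠ_)
open import Data.Fin.Subset using (Subset; ∣_∣; _∈_; _∉_; _⊆_; _∪_; ⁅_⁆; inside; outside)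
open import Data.Fin.Subset.Properties using (_∈?_; p⊆q⇒∣p∣≤∣q∣; ∣p∣≤∣x∷p∣; ∣⁅x⁆∣≡1; x∈⁅x⁆; x∈⁅y⁆⇒x≡y; x∈p∪q⁺)
open import Data.Product using (_×_; _,_; ∃; proj₂)
open import Data.Sum using (inj₁; inj₂)
open import Data.Vec using (Vec; []; _∷_)
open import Data.Vec.Properties using (∷-injectiveˡ)
open import Data.Vec.Relation.Unary.All using (All; []; _∷_)
open import Function.Bundles using (Equivalence)
open import Induction.WellFounded using (Acc; acc)
open import Relation.Binary.PropositionalEquality using (_≡_; _≢_; refl; sym; trans; cong; cong₂; subst; module ≡-Reasoning)
open import Relation.Nullary using (¬_; yes; no; contradiction; ¬?; _×-dec_)
open import Relation.Nullary.Decidable using (decidable-stable)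
open import Relation.Unary using (Pred; Decidable)

∣p∪q∣≤∣p∣+∣q∣ : ∀ {n} (p q : Subset n) → ∣ p ∪ q ∣ ≤ ∣ p ∣ + ∣ q ∣
∣p∪q∣≤∣p∣+∣q∣ []            []           = z≤n
∣p∪q∣≤∣p∣+∣q∣ (inside ∷ p)  (t ∷ q)      = s≤s (≤-trans (∣p∪q∣≤∣p∣+∣q∣ p q) (+-monoʳ-≤ ∣ p ∣ (∣p∣≤∣x∷p∣ t q)))
∣p∪q∣≤∣p∣+∣q∣ (outside ∷ p) (inside ∷ q) = subst (suc ∣ p ∪ q ∣ ≤_) (sym (+-suc ∣ p ∣ ∣ q ∣)) (s≤s (∣p∪q∣≤∣p∣+∣q∣ p q))
∣p∪q∣≤∣p∣+∣q∣ (outside ∷ p) (outside ∷ q) = ∣p∪q∣≤∣p∣+∣q∣ p q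

x∈p⇒0<∣p∣ : ∀ {n} {x : Fin n} {p : Subset n} → x ∈ p → 0 < ∣ p ∣
x∈p⇒0<∣p∣ {x = x} {p} x∈p = begin
  1           ≡⟨ ∣⁅x⁆∣≡1 x ⟨
  ∣ ⁅ x ⁆ ∣   ≤⟨ p⊆q⇒∣p∣≤∣q∣ (λ y∈⁅x⁆ → subst (_∈ p) (sym (x∈⁅y⁆⇒x≡y x y∈⁅x⁆)) x∈p) ⟩
  ∣ p ∣       ∎
  where open ≤-Reasoning

∃≢ : ∀ {n} → 1 < n → (x : Fin n) → ∃ λ y → y ≢ x
∃≢ (s≤s (s≤s z≤n)) x = punchIn x zero , punchInᵢ≢i x zero

least-witness : ∀ {p} {P : Pred ℕ p} → Decidable P → ∀ {m} → P m →
                ∃ λ o → P o × (∀ {j} → j < o → ¬ P j)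
least-witness {P = P} P? = descend (<-wellFounded _)
  where
  descend : ∀ {m} → Acc _<_ m → P m → ∃ λ o → P o × (∀ {j} → j < o → ¬ P j)
  descend {m} (acc below) Pm with anyUpTo? P? m
  ... | yes (j , j<m , Pj) = descend (below j<m) Pj
  ... | no ∄ = m , Pm , λ j<m Pj → ∄ (_ , j<m , Pj)

-- the word x ^ p y ^ (m ∸ p); just x ^ m when p ≥ m
block : ∀ {a} {A : Set a} → ℕ → A → A → (m : ℕ) → Vec A m
block p       x y zero    = []
block zero    x y (suc m) = y ∷ block zero x y m
block (suc p) x y (suc m) = x ∷ block p x y m

block-head-injective : ∀ {a} {A : Set a} {x y : A} {p q m} → 0 < p → 0 < q → 0 < m →
                       block p x y m ≡ block q y x m → x ≡ y
block-head-injective (s≤s _) (s≤s _) (s≤s _) = ∷-injectiveˡ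

All-block : ∀ {a ℓ} {A : Set a} {P : Pred A ℓ} {x y} → P x → P y → ∀ p m → All P (block p x y m)
All-block Px Py p       zero    = []
All-block Px Py zero    (suc m) = Py ∷ All-block Px Py zero m
All-block Px Py (suc p) (suc m) = Px ∷ All-block Px Py p m

module MonoidPowers {n} {_∙_ : Fin n → Fin n → Fin n} {ε : Fin n} (M : IsMonoid _≡_ _∙_ ε) where
  open IsMonoid M using (assoc; identityˡ; identityʳ)

  infixr 30 _^_
  _^_ : Fin n → ℕ → Fin n
  _^_ = pow _∙_ ε

  ^-+ : ∀ g i j → g ^ (i + j) ≡ g ^ i ∙ g ^ j
  ^-+ g zero    j = sym (identityˡ _)
  ^-+ g (suc i) j = trans (cong (g ∙_) (^-+ g i j)) (sym (assoc g _ _))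

  prod-block : ∀ x y p m → p ≤ m → prod _∙_ ε (block p x y m) ≡ x ^ p ∙ y ^ (m ∸ p)
  prod-block x y zero    m       _         = trans (prod-ys m) (sym (identityˡ _))
    where
    prod-ys : ∀ m → prod _∙_ ε (block 0 x y m) ≡ y ^ m
    prod-ys zero    = refl
    prod-ys (suc m) = cong (y ∙_) (prod-ys m)
  prod-block x y (suc p) (suc m) (s≤s p≤m) = trans (cong (x ∙_) (prod-block x y p m p≤m)) (sym (assoc _ _ _))

  nontrivial⇒2≤order : ∀ {g o} → g ≢ ε → HasOrder _∙_ ε g o → 2 ≤ o
  nontrivial⇒2≤order {o = suc zero}    g≢ε (_ , g∙ε≡ε , _) = contradiction (trans (sym (identityʳ _)) g∙ε≡ε) g≢ε
  nontrivial⇒2≤order {o = suc (suc _)} _   _               = s≤s (s≤s z≤n)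

module SkSet {n} {_∙_ : Fin n → Fin n → Fin n} {ε : Fin n} (M : IsMonoid _≡_ _∙_ ε)
             {k} {A : Subset n} (sk : IsSk _∙_ ε k A) where
  open IsMonoid M using (identityˡ; identityʳ)
  open MonoidPowers M
  open ≡-Reasoning

  equal-block-products⇒≡ : ∀ {a b} p q → a ∈ A → b ∈ A → 0 < p → p ≤ k → 0 < q → q ≤ k →
                           a ^ p ∙ b ^ (k ∸ p) ≡ b ^ q ∙ a ^ (k ∸ q) → a ≡ b
  equal-block-products⇒≡ {a} {b} p q a∈A b∈A 0<p p≤k 0<q q≤k eq =
    block-head-injective 0<p 0<q (<-≤-trans 0<p p≤k)
      (sk _ _ (All-block a∈A b∈A p k) (All-block b∈A a∈A q k) (begin
        prod _∙_ ε (block p a b k)  ≡⟨ prod-block a b p k p≤k ⟩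
        a ^ p ∙ b ^ (k ∸ p)         ≡⟨ eq ⟩
        b ^ q ∙ a ^ (k ∸ q)         ≡⟨ prod-block b a q k q≤k ⟨
        prod _∙_ ε (block q b a k)  ∎))

  ^k-injective : ∀ {a b} → 0 < k → a ∈ A → b ∈ A → a ^ k ≡ b ^ k → a ≡ b
  ^k-injective {a} {b} 0<k a∈A b∈A aᵏ≡bᵏ =
    equal-block-products⇒≡ k k a∈A b∈A 0<k ≤-refl 0<k ≤-refl
      (cong₂ _∙_ aᵏ≡bᵏ (trans (cong (b ^_) (n∸n≡0 k)) (sym (cong (a ^_) (n∸n≡0 k)))))

  torsion<k⇒≡ : ∀ {a b p} → a ∈ A → b ∈ A → 0 < p → p < k → a ^ p ≡ ε → a ≡ b
  torsion<k⇒≡ {a} {b} {p} a∈A b∈A 0<p p<k aᵖ≡ε =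
    equal-block-products⇒≡ p (k ∸ p) a∈A b∈A 0<p (<⇒≤ p<k) (m<n⇒0<n∸m p<k) (m∸n≤m k p) (begin
      a ^ p ∙ b ^ (k ∸ p)                ≡⟨ cong (_∙ b ^ (k ∸ p)) aᵖ≡ε ⟩
      ε ∙ b ^ (k ∸ p)                    ≡⟨ identityˡ _ ⟩
      b ^ (k ∸ p)                        ≡⟨ identityʳ _ ⟨
      b ^ (k ∸ p) ∙ ε                    ≡⟨ cong (b ^ (k ∸ p) ∙_) aᵖ≡ε ⟨
      b ^ (k ∸ p) ∙ a ^ p                ≡⟨ cong (λ i → b ^ (k ∸ p) ∙ a ^ i) (m∸[m∸n]≡n (<⇒≤ p<k)) ⟨
      b ^ (k ∸ p) ∙ a ^ (k ∸ (k ∸ p))    ∎)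

  torsion-unique : ∀ {a b p q} → a ∈ A → b ∈ A →
                   0 < p → p ≤ k → a ^ p ≡ ε → 0 < q → q ≤ k → b ^ q ≡ ε → a ≡ b
  torsion-unique {a} {b} {p} {q} a∈A b∈A 0<p p≤k aᵖ≡ε 0<q q≤k bᵠ≡ε with p <? k | q <? k
  ... | yes p<k | _       = torsion<k⇒≡ a∈A b∈A 0<p p<k aᵖ≡ε
  ... | no _    | yes q<k = sym (torsion<k⇒≡ b∈A a∈A 0<q q<k bᵠ≡ε)
  ... | no p≮k  | no q≮k  = ^k-injective (<-≤-trans 0<p p≤k) a∈A b∈A (begin
    a ^ k  ≡⟨ cong (a ^_) (≤-antisym p≤k (≮⇒≥ p≮k)) ⟨
    a ^ p  ≡⟨ aᵖ≡ε ⟩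
    ε      ≡⟨ bᵠ≡ε ⟨
    b ^ q  ≡⟨ cong (b ^_) (≤-antisym q≤k (≮⇒≥ q≮k)) ⟩
    b ^ k  ∎)

  ε∈A⇒A⊆⁅ε⁆ : 1 < k → ε ∈ A → A ⊆ ⁅ ε ⁆
  ε∈A⇒A⊆⁅ε⁆ 1<k ε∈A b∈A = subst (_∈ ⁅ ε ⁆) (torsion<k⇒≡ ε∈A b∈A (s≤s z≤n) 1<k (identityʳ ε)) (x∈⁅x⁆ ε)

module FiniteGroupOrder {n} {_∙_ : Fin n → Fin n → Fin n} {ε : Fin n} {_⁻¹ : Fin n → Fin n}
                        (G : IsGroup _≡_ _∙_ ε _⁻¹) where
  open IsGroup G using (isMonoid)
  open MonoidPowers isMonoid

  group : Group _ _
  group = record { isGroup = G }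

  open import Algebra.Properties.Group group using (identityʳ-unique)
  open ≡-Reasoning

  torsion : ∀ g → ∃ λ m → 0 < m × g ^ m ≡ ε
  torsion g with pigeonhole (n<1+n n) (λ i → g ^ toℕ i)
  ... | i , j , i<j , gⁱ≡gʲ = toℕ j ∸ toℕ i , m<n⇒0<n∸m i<j , identityʳ-unique (g ^ toℕ i) _ (begin
    g ^ toℕ i ∙ g ^ (toℕ j ∸ toℕ i)  ≡⟨ ^-+ g (toℕ i) _ ⟨
    g ^ (toℕ i + (toℕ j ∸ toℕ i))    ≡⟨ cong (g ^_) (m+[n∸m]≡n (<⇒≤ i<j)) ⟩
    g ^ toℕ j                        ≡⟨ gⁱ≡gʲ ⟨
    g ^ toℕ i                        ∎)

  order : ∀ g → ∃ (HasOrder _∙_ ε g)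
  order g with least-witness (λ m → (0 <? m) ×-dec (g ^ m ≟ᶠ ε)) (proj₂ (torsion g))
  ... | o , (0<o , gᵒ≡ε) , below = o , 0<o , gᵒ≡ε , λ j 0<j j<o gʲ≡ε → below j<o (0<j , gʲ≡ε)

module Counting {n k} {_∙_ : Fin n → Fin n → Fin n} {ε : Fin n} {_⁻¹ : Fin n → Fin n}
                (G : IsGroup _≡_ _∙_ ε _⁻¹)
                {L : Subset (suc k)} (isL : IsMkSet _∙_ ε k L)
                {N : Subset n} (isN : IsNkSet _∙_ ε k N) where
  open IsGroup G using (isMonoid)
  open MonoidPowers isMonoid
  open FiniteGroupOrder G

  ∉N⇒order≤k : ∀ {g} → g ∉ N → ∃ λ o → HasOrder _∙_ ε g o × o ≤ k
  ∉N⇒order≤k {g} g∉N with order g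
  ... | o , ord with o ≤? k
  ...   | yes o≤k = o , ord , o≤k
  ...   | no o≰k  = contradiction (Equivalence.from (isN g) (o , ord , ≰⇒> o≰k)) g∉N

  order∈L : ∀ {g o} → HasOrder _∙_ ε g o → 2 ≤ o → o ≤ k → 0 < ∣ L ∣
  order∈L {g} {o} ord 2≤o o≤k = x∈p⇒0<∣p∣ (Equivalence.from (isL ℓ)
    (subst (2 ≤_) (sym toℕℓ≡o) 2≤o , g , subst (HasOrder _∙_ ε g) (sym toℕℓ≡o) ord))
    where
    ℓ : Fin (suc k)
    ℓ = fromℕ< (s≤s o≤k)
    toℕℓ≡o : toℕ ℓ ≡ o
    toℕℓ≡o = toℕ-fromℕ< (s≤s o≤k)

  nontrivial∉N⇒0<∣L∣ : ∀ {g} → g ≢ ε → g ∉ N → 0 < ∣ L ∣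
  nontrivial∉N⇒0<∣L∣ g≢ε g∉N with ∉N⇒order≤k g∉N
  ... | o , ord , o≤k = order∈L ord (nontrivial⇒2≤order g≢ε ord) o≤k

  nontrivial⇒0<∣L∣+∣N∣ : ∀ {g} → g ≢ ε → 0 < ∣ L ∣ + ∣ N ∣
  nontrivial⇒0<∣L∣+∣N∣ {g} g≢ε with g ∈? N
  ... | yes g∈N = ≤-trans (x∈p⇒0<∣p∣ g∈N) (m≤n+m ∣ N ∣ ∣ L ∣)
  ... | no g∉N  = ≤-trans (nontrivial∉N⇒0<∣L∣ g≢ε g∉N) (m≤m+n ∣ L ∣ ∣ N ∣)

  a∉N⇒A⊆N∪⁅a⁆ : ∀ {A} → IsSk _∙_ ε k A → ∀ {a} → a ∈ A → a ∉ N → A ⊆ N ∪ ⁅ a ⁆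
  a∉N⇒A⊆N∪⁅a⁆ sk {a} a∈A a∉N {b} b∈A with b ∈? N | ∉N⇒order≤k a∉N
  ... | yes b∈N | _ = x∈p∪q⁺ (inj₁ b∈N)
  ... | no b∉N  | p , (0<p , aᵖ≡ε , _) , p≤k with ∉N⇒order≤k b∉N
  ...   | q , (0<q , bᵠ≡ε , _) , q≤k =
    x∈p∪q⁺ (inj₂ (subst (_∈ ⁅ a ⁆) (SkSet.torsion-unique isMonoid sk a∈A b∈A 0<p p≤k aᵖ≡ε 0<q q≤k bᵠ≡ε) (x∈⁅x⁆ a)))

proposition6p6 : (n k : ℕ) → 2 ≤ k → 1 < n →
    (_∙_ : Fin n → Fin n → Fin n) (ε : Fin n) (_⁻¹ : Fin n → Fin n) →
    IsGroup _≡_ _∙_ ε _⁻¹ →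
    (L : Subset (suc k)) → IsMkSet _∙_ ε k L →
    (N : Subset n) → IsNkSet _∙_ ε k N →
    (A : Subset n) → IsSk _∙_ ε k A →
    ∣ A ∣ ≤ ∣ L ∣ + ∣ N ∣
proposition6p6 n k 1<k 1<n _∙_ ε _⁻¹ G L isL N isN A sk = bound
  where
  open IsGroup G using (isMonoid)
  open SkSet isMonoid sk using (ε∈A⇒A⊆⁅ε⁆)
  open Counting G isL isN
  open ≤-Reasoning

  bound : ∣ A ∣ ≤ ∣ L ∣ + ∣ N ∣
  bound with any? (λ x → (x ∈? A) ×-dec ¬? (x ∈? N))
  ... | no ∄a∈A∖N = begin
    ∣ A ∣          ≤⟨ p⊆q⇒∣p∣≤∣q∣ (λ {x} x∈A → decidable-stable (x ∈? N) (λ x∉N → ∄a∈A∖N (x , x∈A , x∉N))) ⟩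
    ∣ N ∣          ≤⟨ m≤n+m ∣ N ∣ ∣ L ∣ ⟩
    ∣ L ∣ + ∣ N ∣  ∎
  ... | yes (a , a∈A , a∉N) with a ≟ᶠ ε
  ...   | yes refl = begin
    ∣ A ∣          ≤⟨ p⊆q⇒∣p∣≤∣q∣ (ε∈A⇒A⊆⁅ε⁆ 1<k a∈A) ⟩
    ∣ ⁅ ε ⁆ ∣      ≡⟨ ∣⁅x⁆∣≡1 ε ⟩
    1              ≤⟨ nontrivial⇒0<∣L∣+∣N∣ (proj₂ (∃≢ 1<n ε)) ⟩
    ∣ L ∣ + ∣ N ∣  ∎
  ...   | no a≢ε   = begin
    ∣ A ∣              ≤⟨ p⊆q⇒∣p∣≤∣q∣ (a∉N⇒A⊆N∪⁅a⁆ sk a∈A a∉N) ⟩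
    ∣ N ∪ ⁅ a ⁆ ∣      ≤⟨ ∣p∪q∣≤∣p∣+∣q∣ N ⁅ a ⁆ ⟩
    ∣ N ∣ + ∣ ⁅ a ⁆ ∣  ≡⟨ cong (∣ N ∣ +_) (∣⁅x⁆∣≡1 a) ⟩
    ∣ N ∣ + 1          ≤⟨ +-monoʳ-≤ ∣ N ∣ (nontrivial∉N⇒0<∣L∣ a≢ε a∉N) ⟩
    ∣ N ∣ + ∣ L ∣      ≡⟨ +-comm ∣ N ∣ ∣ L ∣ ⟩
    ∣ L ∣ + ∣ N ∣      ∎
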